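{- Let $F$ be a clause-set, $k\in\mathbb{N}_0$, $\mathbb{P}$ a $k$-consistent set of partial assignments for $F$, and $F_1,\dots,F_p$ a semantic $k$-sequence for $F$. Then there exist $\varphi_1,\dots,\varphi_p\in\mathbb{P}$ with $\varphi_i*F_i=\top$ for each $i\in\{1,\dots,p\}$.
   Context: Literals are variables $v$ or negations $\overline{v}$; clauses finite sets of literals without complementary pair; clause-sets finite sets of clauses; $\bot$ empty clause, $\top$ empty clause-set, $c(F)$ number of clauses, $\mathrm{var}(F)$ variables of $F$. A partial assignment $\varphi$ maps a finite variable set $\mathrm{var}(\varphi)$ to $\{0,1\}$, $n(\varphi)=|\mathrm{var}(\varphi)|$; $\langle v\to\varepsilon\rangle$ sets only $v$; $\varphi*F$ removes satisfied clauses and false literals. $F\models G$ iff every $\varphi$ with $\varphi*F=\top$ has $\varphi*G=\top$. Semantic $k$-sequence for $F$: $F_1,\dots,F_p$ with $c(F_i)\le k$ for all $i$, $F_1=\top$, and for each $i\ge2$ either $F_{i-1}\models F_i$ or $F_i=F_{i-1}\cup\{C\}$ for some $C\in F$. $\mathbb{P}$ is minimally consistent for $F$ if $\mathbb{P}\ne\emptyset$, $\mathrm{var}(\varphi)\subseteq\mathrm{var}(F)$ and $\bot\notin\varphi*F$ for all $\varphi\in\mathbb{P}$; it is $k$-consistent if moreover for all $\varphi\in\mathbb{P}$, $v\in\mathrm{var}(F)\setminus\mathrm{var}(\varphi)$, $\psi\subseteq\varphi$ with $n(\psi)<k$ and both $\varepsilon\in\{0,1\}$ there is $\varphi'\in\mathbb{P}$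 with $\psi\cup\langle v\to\varepsilon\rangle\subseteq\varphi'$. -}

module Defs where

open import Data.Nat using (ℕ; _≤_; _<_)
open import Data.Bool using (Bool; not)
open import Data.Product using (Σ; ∃; _×_; _,_; proj₁)
open import Data.Sum using (_⊎_)
open import Data.Empty using (⊥)
open import Data.List using (List; []; _∷_; map; length)
open import Data.List.Membership.Propositional using (_∈_; _∉_)
open import Data.List.Relation.Unary.All using (All)
open import Data.List.Relation.Unary.Unique.Propositional using (Unique)
open import Data.List.Relation.Unary.Linked using (Linked)
open import Relation.Nullary using (¬_)
open import Relation.Binary.PropositionalEquality using (_≡_)

Var : Set
Var = ℕ

-- A literal (v , true) is the positive literal v, (v , false) is the negation of v.
Lit : Set
Lit = Var × Bool

-- A clause is a finite set of literals, represented by a list (set semantics: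
-- only membership matters).
Clause : Set
Clause = List Lit

WFClause : Clause → Set
WFClause C = ∀ v b → (v , b) ∈ C → (v , not b) ∈ C → ⊥

ClauseSet : Set
ClauseSet = List Clause

WFClauseSet : ClauseSet → Set
WFClauseSet F = All WFClause F

_≈C_ : Clause → Clause → Set
C ≈C D = (∀ x → x ∈ C → x ∈ D) × (∀ x → x ∈ D → x ∈ C)

_∈C_ : Clause → ClauseSet → Set
C ∈C F = Σ Clause λ D → D ∈ F × D ≈C C

-- c(F) ≤ k : F has at most k distinct clauses (as sets of literals),
-- i.e. there is a list of k clauses containing all clauses of F
AtMostClauses : ℕ → ClauseSet → Set
AtMostClauses k F = Σ ClauseSet λ L → length L ≡ k × (∀ C → C ∈ F → C ∈C L)

-- G = H ∪ {C} as sets of clauses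
IsUnionWith : ClauseSet → ClauseSet → Clause → Set
IsUnionWith G H C =
  (∀ D → D ∈ G → D ∈C H ⊎ D ≈C C) × ((∀ D → D ∈ H → D ∈C G) × C ∈C G)

_∈var_ : Var → ClauseSet → Set
v ∈var F = Σ Clause λ C → C ∈ F × Σ Bool λ b → (v , b) ∈ C

-- A partial assignment is a list of pairs (v , ε) meaning v ↦ ε, with
-- pairwise distinct variables (so it is a function on a finite domain).
PAss : Set
PAss = List (Var × Bool)

IsPA : PAss → Set
IsPA φ = Unique (map proj₁ φ)

_∈dom_ : Var → PAss → Set
v ∈dom φ = Σ Bool λ ε → (v , ε) ∈ φ

n : PAss → ℕ
n φ = length φ

_⊆PA_ : PAss → PAss → Set
ψ ⊆PA φ = ∀ x → x ∈ ψ → x ∈ φ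

SatLit : PAss → Lit → Set
SatLit φ x = x ∈ φ

FalsLit : PAss → Lit → Set
FalsLit φ (v , b) = (v , not b) ∈ φ

-- φ * F = ⊤ : every clause of F is satisfied by φ
SatCS : PAss → ClauseSet → Set
SatCS φ F = ∀ C → C ∈ F → Σ Lit λ x → x ∈ C × SatLit φ x

FalsifiesCS : PAss → ClauseSet → Set
FalsifiesCS φ F = Σ Clause λ C → C ∈ F × (∀ x → x ∈ C → FalsLit φ x)

_⊨_ : ClauseSet → ClauseSet → Set
F ⊨ G = ∀ φ → IsPA φ → SatCS φ F → SatCS φ G

SemStep : ClauseSet → ClauseSet → ClauseSet → Set
SemStep F G H = (G ⊨ H) ⊎ (Σ Clause λ C → C ∈ F × IsUnionWith H G C)

-- semantic k-sequence F₁,…,F_p for F (given as the list F₁ ∷ … ∷ F_p);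
-- F₁ = ⊤ forces p ≥ 1.
SemanticSeq : ℕ → ClauseSet → List ClauseSet → Set
SemanticSeq k F Fs =
  All WFClauseSet Fs × All (AtMostClauses k) Fs
  × (Σ (List ClauseSet) λ rest → Fs ≡ [] ∷ rest)
  × Linked (SemStep F) Fs

-- sets of partial assignments are predicates on (representations of) PAs
MinimallyConsistent : ClauseSet → (PAss → Set) → Set
MinimallyConsistent F P =
  (Σ PAss λ φ → P φ)
  × (∀ φ → P φ → IsPA φ × (∀ v → v ∈dom φ → v ∈var F) × ¬ FalsifiesCS φ F)

KConsistent : ℕ → ClauseSet → (PAss → Set) → Set
KConsistent k F P =
  MinimallyConsistent F P
  × (∀ φ → P φ → ∀ v → v ∈var F → ¬ (v ∈dom φ) →
       ∀ ψ → IsPA ψ → ψ ⊆PA φ → n ψ < k → ∀ ε →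
       Σ PAss λ φ' → P φ' × ψ ⊆PA φ' × (v , ε) ∈ φ')

-- Walk along the sequence, keeping an assignment of P that satisfies the current
-- clause-set. Semantic steps keep it. When a clause C is added and not yet satisfied,
-- restrict the assignment to one satisfying literal per satisfied clause: since
-- c(F_i) ≤ k and C is among the unsatisfied ones, fewer than k variables remain.
-- Minimal consistency yields a literal of C whose variable is still free, and
-- k-consistency extends the restriction to satisfy that literal as well.
module Submission where

open import Defs
open import Data.Nat using (ℕ; _≤_; _<_; z≤n; s≤s)
open import Data.Nat.Properties using (≤-trans; ≤-<-trans) renaming (_≟_ to _≟ℕ_)
open import Data.Bool using (not) renaming (_≟_ to _≟B_)
open import Data.Bool.Properties using (¬-not)
open import Data.Product using (Σ; _×_; _,_; proj₁; proj₂; swap)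
open import Data.Product.Properties using (≡-dec)
open import Data.Sum using (inj₁; inj₂)
open import Data.List using (List; []; _∷_; length; filter; deduplicate)
open import Data.List.Properties using (filter-notAll; length-deduplicate)
open import Data.List.Relation.Binary.Pointwise using (Pointwise; []; _∷_)
open import Data.List.Relation.Unary.Any as Any using (here; there; any?)
open import Data.List.Relation.Unary.All as All using (All; []; _∷_; all?)
open import Data.List.Relation.Unary.AllPairs using ([]; _∷_)
open import Data.List.Relation.Unary.All.Properties using (all-filter; ¬All⇒Any¬; map⁺)
open import Data.List.Relation.Unary.Linked using (Linked; [-]; _∷_)
open import Data.List.Relation.Unary.Unique.Propositional using (Unique)
open import Data.List.Relation.Unary.Unique.DecPropositional.Properties using (deduplicate-!)
open import Data.List.Membership.Propositional using (_∈_; find; lose)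
open import Data.List.Membership.Propositional.Properties
  using (∈-map⁺; ∈-filter⁺; ∈-deduplicate⁺; ∈-deduplicate⁻)
open import Data.List.Membership.DecPropositional (≡-dec _≟ℕ_ _≟B_) using (_∈?_)
open import Relation.Nullary using (¬_; Dec; yes; no; contradiction)
import Relation.Nullary.Decidable as Dec
open import Relation.Binary.PropositionalEquality using (_≡_; _≢_; refl; cong; subst)

_≟Lit_ : (x y : Lit) → Dec (x ≡ y)
_≟Lit_ = ≡-dec _≟ℕ_ _≟B_

IsPA-functional : ∀ {φ v a b} → IsPA φ → (v , a) ∈ φ → (v , b) ∈ φ → a ≡ b
IsPA-functional _            (here refl)  (here refl)  = refl
IsPA-functional (v∉φ ∷ _)    (here refl)  (there vb∈φ) =
  contradiction refl (All.lookup v∉φ (∈-map⁺ proj₁ vb∈φ))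
IsPA-functional (v∉φ ∷ _)    (there va∈φ) (here refl)  =
  contradiction refl (All.lookup v∉φ (∈-map⁺ proj₁ va∈φ))
IsPA-functional (_ ∷ φ-isPA) (there va∈φ) (there vb∈φ) = IsPA-functional φ-isPA va∈φ vb∈φ

IsPA-distinct-vars : ∀ {φ x y} → IsPA φ → x ∈ φ → y ∈ φ → x ≢ y → proj₁ x ≢ proj₁ y
IsPA-distinct-vars {x = v , a} {y = .v , b} φ-isPA x∈φ y∈φ x≢y refl =
  x≢y (cong (v ,_) (IsPA-functional φ-isPA x∈φ y∈φ))

Unique-⊆PA-IsPA : ∀ {φ ψ} → IsPA φ → Unique ψ → ψ ⊆PA φ → IsPA ψ
Unique-⊆PA-IsPA φ-isPA []               _   = []
Unique-⊆PA-IsPA φ-isPA (x≢ψ ∷ ψ-uniq) ψ⊆φ =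
  map⁺ (All.tabulate λ {y} y∈ψ →
    IsPA-distinct-vars φ-isPA (ψ⊆φ _ (here refl)) (ψ⊆φ _ (there y∈ψ)) (All.lookup x≢ψ y∈ψ))
  ∷ Unique-⊆PA-IsPA φ-isPA ψ-uniq (λ y y∈ψ → ψ⊆φ y (there y∈ψ))

SatClause : PAss → Clause → Set
SatClause φ C = Σ Lit λ x → x ∈ C × SatLit φ x

satClause? : ∀ φ C → Dec (SatClause φ C)
satClause? φ C = Dec.map′ find (λ (_ , x∈C , x∈φ) → lose x∈C x∈φ) (any? (_∈? φ) C)

SatClause-mono : ∀ {φ φ' C} → φ ⊆PA φ' → SatClause φ C → SatClause φ' C
SatClause-mono φ⊆φ' (x , x∈C , x∈φ) = x , x∈C , φ⊆φ' x x∈φ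

SatClause-resp-≈C : ∀ {φ C D} → C ≈C D → SatClause φ C → SatClause φ D
SatClause-resp-≈C (C⊆D , _) (x , x∈C , x∈φ) = x , C⊆D x x∈C , x∈φ

≈C-trans : ∀ {C D E} → C ≈C D → D ≈C E → C ≈C E
≈C-trans (C⊆D , D⊆C) (D⊆E , E⊆D) =
  (λ x x∈C → D⊆E x (C⊆D x x∈C)) , (λ x x∈E → D⊆C x (E⊆D x x∈E))

∈C-cover : ∀ {H L D} → (∀ C → C ∈ H → C ∈C L) → D ∈C H → D ∈C L
∈C-cover cover (D' , D'∈H , D'≈D) with cover D' D'∈H
... | E , E∈L , E≈D' = E , E∈L , ≈C-trans E≈D' D'≈D

SatCS-unionWith : ∀ {φ G H C} → IsUnionWith H G C → SatCS φ G → SatClause φ C → SatCS φ H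
SatCS-unionWith (H⊆G∪C , _) φ⊨G φ⊨C D D∈H with H⊆G∪C D D∈H
... | inj₁ (E , E∈G , E≈D) = SatClause-resp-≈C E≈D (φ⊨G E E∈G)
... | inj₂ D≈C             = SatClause-resp-≈C (swap D≈C) φ⊨C

SatCS-via-cover : ∀ {φ ψ G L} → (∀ D → D ∈ G → D ∈C L) → SatCS φ G →
  All (SatClause ψ) (filter (satClause? φ) L) → SatCS ψ G
SatCS-via-cover G⊆L φ⊨G ψ⊨sat E E∈G with G⊆L E E∈G
... | D , D∈L , D≈E = SatClause-resp-≈C D≈E
  (All.lookup ψ⊨sat (∈-filter⁺ (satClause? _) D∈L (SatClause-resp-≈C (swap D≈E) (φ⊨G E E∈G))))

satisfying-literals : ∀ {φ M} → All (SatClause φ) M →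
  Σ PAss λ xs → xs ⊆PA φ × length xs ≤ length M × All (SatClause xs) M
satisfying-literals []                      = [] , (λ _ ()) , z≤n , []
satisfying-literals ((x , x∈C , x∈φ) ∷ φ⊨M) with satisfying-literals φ⊨M
... | xs , xs⊆φ , xs≤M , xs⊨M =
  x ∷ xs , (λ { _ (here refl) → x∈φ ; y (there y∈xs) → xs⊆φ y y∈xs }) , s≤s xs≤M
  , (x , x∈C , here refl) ∷ All.map (SatClause-mono (λ _ → there)) xs⊨M

small-support : ∀ {φ M} → IsPA φ → All (SatClause φ) M →
  Σ PAss λ ψ → IsPA ψ × ψ ⊆PA φ × n ψ ≤ length M × All (SatClause ψ) M
small-support {φ} φ-isPA φ⊨M with satisfying-literals φ⊨M
... | xs , xs⊆φ , xs≤M , xs⊨M =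
  deduplicate _≟Lit_ xs
  , Unique-⊆PA-IsPA φ-isPA (deduplicate-! _≟Lit_ xs) ψ⊆φ
  , ψ⊆φ
  , ≤-trans (length-deduplicate _≟Lit_ xs) xs≤M
  , All.map (SatClause-mono (λ _ → ∈-deduplicate⁺ _≟Lit_)) xs⊨M
  where
  ψ⊆φ : deduplicate _≟Lit_ xs ⊆PA φ
  ψ⊆φ y y∈ψ = xs⊆φ y (∈-deduplicate⁻ _≟Lit_ xs y∈ψ)

free-literal : ∀ {φ C} → ¬ SatClause φ C → ¬ (∀ x → x ∈ C → FalsLit φ x) →
  Σ Lit λ x → x ∈ C × ¬ (proj₁ x ∈dom φ)
free-literal {φ} {C} φ⊭C ¬φ⊥C with all? (λ (v , b) → (v , not b) ∈? φ) C
... | yes allFalse = contradiction (λ x x∈C → All.lookup allFalse x∈C) ¬φ⊥C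
... | no ¬allFalse with find (¬All⇒Any¬ (λ (v , b) → (v , not b) ∈? φ) C ¬allFalse)
...   | (v , b) , vb∈C , ¬vb̄∈φ = (v , b) , vb∈C , v∉φ
  where
  v∉φ : ¬ (v ∈dom φ)
  v∉φ (ε , vε∈φ) with ε ≟B b
  ... | yes refl = φ⊭C ((v , b) , vb∈C , vε∈φ)
  ... | no ε≢b   = ¬vb̄∈φ (subst (λ e → (v , e) ∈ φ) (¬-not ε≢b) vε∈φ)

module _ {k F P} (kc : KConsistent k F P) where

  private
    P-isPA : ∀ {φ} → P φ → IsPA φ
    P-isPA Pφ = proj₁ (proj₂ (proj₁ kc) _ Pφ)

    P-consistent : ∀ {φ} → P φ → ¬ FalsifiesCS φ F
    P-consistent Pφ = proj₂ (proj₂ (proj₂ (proj₁ kc) _ Pφ))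

  satisfy-unsatisfied-clause : ∀ {φ G H C} → P φ → SatCS φ G → (∀ D → D ∈ G → D ∈C H) →
    AtMostClauses k H → C ∈ F → C ∈C H → ¬ SatClause φ C →
    Σ PAss λ φ' → P φ' × SatCS φ' G × SatClause φ' C
  satisfy-unsatisfied-clause {φ} {G} {H} {C} Pφ φ⊨G G⊆H (L , L≡k , H⊆L) C∈F C∈H φ⊭C
    with free-literal φ⊭C (λ φ⊥C → P-consistent Pφ (C , C∈F , φ⊥C))
       | small-support (P-isPA Pφ) (all-filter (satClause? φ) L)
       | ∈C-cover H⊆L C∈H
  ... | (v , b) , vb∈C , v∉φ | ψ , ψ-isPA , ψ⊆φ , ψ≤sat , ψ⊨sat | D₀ , D₀∈L , D₀≈C
    with proj₂ kc φ Pφ v (C , C∈F , b , vb∈C) v∉φ ψ ψ-isPA ψ⊆φ ψ<k b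
    where
    ψ<k : n ψ < k
    ψ<k = subst (n ψ <_) L≡k (≤-<-trans ψ≤sat (filter-notAll (satClause? φ) L
            (Any.map (λ { refl φ⊨D₀ → φ⊭C (SatClause-resp-≈C D₀≈C φ⊨D₀) }) D₀∈L)))
  ... | φ' , Pφ' , ψ⊆φ' , vb∈φ' =
    φ' , Pφ'
    , SatCS-via-cover (λ E E∈G → ∈C-cover H⊆L (G⊆H E E∈G)) φ⊨G
        (All.map (SatClause-mono ψ⊆φ') ψ⊨sat)
    , ((v , b) , vb∈C , vb∈φ')

  semantic-step : ∀ {φ G H} → P φ → SatCS φ G → AtMostClauses k H → SemStep F G H →
    Σ PAss λ φ' → P φ' × SatCS φ' H
  semantic-step {φ} Pφ φ⊨G _ (inj₁ G⊨H) = φ , Pφ , G⊨H φ (P-isPA Pφ) φ⊨G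
  semantic-step {φ} Pφ φ⊨G H≤k (inj₂ (C , C∈F , H≡G∪C@(_ , G⊆H , C∈H))) with satClause? φ C
  ... | yes φ⊨C = φ , Pφ , SatCS-unionWith H≡G∪C φ⊨G φ⊨C
  ... | no φ⊭C with satisfy-unsatisfied-clause Pφ φ⊨G G⊆H H≤k C∈F C∈H φ⊭C
  ...   | φ' , Pφ' , φ'⊨G , φ'⊨C = φ' , Pφ' , SatCS-unionWith H≡G∪C φ'⊨G φ'⊨C

  follow-sequence : ∀ {φ G Gs} → P φ → SatCS φ G → All (AtMostClauses k) (G ∷ Gs) →
    Linked (SemStep F) (G ∷ Gs) →
    Σ (List PAss) λ φs → Pointwise (λ φ G → P φ × SatCS φ G) φs (G ∷ Gs)
  follow-sequence {φ} Pφ φ⊨G _ [-] = φ ∷ [] , (Pφ , φ⊨G) ∷ []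
  follow-sequence {φ} Pφ φ⊨G (_ ∷ Gs≤k@(H≤k ∷ _)) (step ∷ steps)
    with semantic-step Pφ φ⊨G H≤k step
  ... | φ' , Pφ' , φ'⊨H with follow-sequence Pφ' φ'⊨H Gs≤k steps
  ...   | φs , φs⊨Gs = φ ∷ φs , (Pφ , φ⊨G) ∷ φs⊨Gs

lemma6p1 : (F : ClauseSet) → WFClauseSet F → (k : ℕ) → (P : PAss → Set) →
    KConsistent k F P → (Fs : List ClauseSet) → SemanticSeq k F Fs →
    Σ (List PAss) (λ φs → Pointwise (λ φ G → P φ × SatCS φ G) φs Fs)
lemma6p1 F _ k P kc@(((φ , Pφ) , _) , _) .([] ∷ Fs) (_ , Fs≤k , (Fs , refl) , steps) =
  follow-sequence kc Pφ (λ _ ()) Fs≤k steps
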